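{- Let $\mathcal{C}$ be a univalent wild bicategory with an orthogonal factorization system $(\mathcal{L},\mathcal{R})$. Then: 1. $\mathcal{L}={}^{\perp}\mathcal{R}$, i.e. a morphism is in $\mathcal{L}$ if and only if it has the left lifting property against $\mathcal{R}$; 2. $\mathcal{L}^{\perp}=\mathcal{R}$, i.e. a morphism is in $\mathcal{R}$ if and only if it has the right lifting property against $\mathcal{L}$.
   Context: Wild categories and bicategories. A wild category has objects, hom-types, composition, identities and identifications $\mathsf{Rid},\mathsf{Lid},\mathsf{assoc}$ (unit laws and associativity). A wild bicategory additionally satisfies the pentagon identity for $\mathsf{assoc}$ and the triangle identity $$\mathsf{assoc}(g,\mathsf{id},h)\cdot\mathsf{ap}_{g\circ- }(\mathsf{Lid}(h))=\mathsf{ap}_{ -\circ h}(\mathsf{Rid}(g)).$$ It is univalent if identifications of objects are equivalent, via the canonical map, to bi-invertible morphisms. Orthogonal factorization systems. An OFS consists of proposition-valued predicates $\mathcal{L},\mathcal{R}$ on morphisms such that: - both contain identities and are closed under composition; - every morphism $h$ has a contractible type of factorizations $\sum_D\sum_f\sum_g (g\circ f=h)\times\mathcal{L}(f)\times\mathcal{R}(g)$. Fillers. For a square with $f:A\to C$, $l:A\to B$, $r:C\to D$, $g:B\to D$ and $S:g\circ l=r\circ f$, $$\mathsf{fill}(S):=\sum_{d:B\to C}\ \sum_{H_f:d\circ l=f}\ \sum_{H_g:r\circ d=g}\ \mathsf{assoc}(r,d,l)\cdot\mathsf{ap}_{r\circ- }(H_f)=\mathsf{ap}_{ -\circ l}(H_g)\cdot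 S.$$ Lifting properties. - $l$ has the left lifting property against a predicate $\mathcal{H}$ (written ${}^\perp\mathcal{H}(l)$) if for every $r$ with $\mathcal{H}(r)$ and every such square $S$, $\mathsf{fill}(S)$ is contractible. - Dually, $r$ has the right lifting property against $\mathcal{H}$ if for every $l$ with $\mathcal{H}(l)$ and every such square, $\mathsf{fill}(S)$ is contractible. -}

{-# OPTIONS --without-K #-}
module Defs where

open import Level using (Level; _⊔_; suc)
open import Data.Product using (Σ; Σ-syntax; _×_; _,_; proj₁; proj₂)
open import Relation.Binary.PropositionalEquality using (_≡_; refl; trans; cong)

isContr : ∀ {a} → Set a → Set a
isContr A = Σ[ x ∈ A ] ((y : A) → x ≡ y)

isProp : ∀ {a} → Set a → Set a
isProp A = (x y : A) → x ≡ y

fiber : ∀ {a b} {A : Set a} {B : Set b} → (A → B) → B → Set (a ⊔ b)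
fiber {A = A} f y = Σ[ x ∈ A ] (f x ≡ y)

isEquiv : ∀ {a b} {A : Set a} {B : Set b} → (A → B) → Set (a ⊔ b)
isEquiv {B = B} f = (y : B) → isContr (fiber f y)

infixr 30 _·_
_·_ : ∀ {a} {A : Set a} {x y z : A} → x ≡ y → y ≡ z → x ≡ z
_·_ = trans

ap : ∀ {a b} {A : Set a} {B : Set b} (f : A → B) {x y : A} → x ≡ y → f x ≡ f y
ap = cong

record WildCat (i j : Level) : Set (suc (i ⊔ j)) where
  infixr 9 _∘_
  field
    Ob    : Set i
    Hom   : Ob → Ob → Set j
    _∘_   : ∀ {A B C} → Hom B C → Hom A B → Hom A C
    idₕ   : ∀ {A} → Hom A A
    Rid   : ∀ {A B} (f : Hom A B) → f ∘ idₕ ≡ f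
    Lid   : ∀ {A B} (f : Hom A B) → idₕ ∘ f ≡ f
    assoc : ∀ {A B C D} (h : Hom C D) (g : Hom B C) (f : Hom A B)
            → (h ∘ g) ∘ f ≡ h ∘ (g ∘ f)

record WildBicat (i j : Level) : Set (suc (i ⊔ j)) where
  field
    cat : WildCat i j
  open WildCat cat
  field
    pentagon : ∀ {A B C D E} (k : Hom D E) (h : Hom C D) (g : Hom B C) (f : Hom A B)
      → ap (_∘ f) (assoc k h g) · assoc k (h ∘ g) f · ap (k ∘_) (assoc h g f)
        ≡ assoc (k ∘ h) g f · assoc k h (g ∘ f)
    triangle : ∀ {A B C} (g : Hom B C) (h : Hom A B)
      → assoc g idₕ h · ap (g ∘_) (Lid h) ≡ ap (_∘ h) (Rid g)
  open WildCat cat public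

module _ {i j : Level} (C : WildCat i j) where
  open WildCat C

  isBiInv : ∀ {a b} → Hom a b → Set j
  isBiInv {a} {b} f = (Σ[ g ∈ Hom b a ] (g ∘ f ≡ idₕ)) × (Σ[ h ∈ Hom b a ] (f ∘ h ≡ idₕ))

  BiInv : Ob → Ob → Set j
  BiInv a b = Σ[ f ∈ Hom a b ] isBiInv f

  idtoBiInv : ∀ {a b} → a ≡ b → BiInv a b
  idtoBiInv refl = idₕ , ((idₕ , Lid idₕ) , (idₕ , Lid idₕ))

  isUnivalent : Set (i ⊔ j)
  isUnivalent = ∀ (a b : Ob) → isEquiv (idtoBiInv {a} {b})

  MorPred : (k : Level) → Set (i ⊔ j ⊔ suc k)
  MorPred k = ∀ {a b} → Hom a b → Set k

  -- type of fillers of a square S : g ∘ l ≡ r ∘ f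
  --   A --f--> C
  --   l        r
  --   B --g--> D
  fill : ∀ {A B C' D} {f : Hom A C'} {l : Hom A B} {r : Hom C' D} {g : Hom B D}
         → g ∘ l ≡ r ∘ f → Set j
  fill {A} {B} {C'} {D} {f} {l} {r} {g} S =
    Σ[ d ∈ Hom B C' ] Σ[ Hf ∈ d ∘ l ≡ f ] Σ[ Hg ∈ r ∘ d ≡ g ]
      (assoc r d l · ap (r ∘_) Hf ≡ ap (_∘ l) Hg · S)

  LLP : ∀ {k} → MorPred k → MorPred (i ⊔ j ⊔ k)
  LLP H {A} {B} l = ∀ {C' D} (f : Hom A C') (r : Hom C' D) (g : Hom B D)
                    → H r → (S : g ∘ l ≡ r ∘ f) → isContr (fill S)

  RLP : ∀ {k} → MorPred k → MorPred (i ⊔ j ⊔ k)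
  RLP H {C'} {D} r = ∀ {A B} (f : Hom A C') (l : Hom A B) (g : Hom B D)
                     → H l → (S : g ∘ l ≡ r ∘ f) → isContr (fill S)

  record OFS (k : Level) : Set (i ⊔ j ⊔ suc k) where
    field
      L : MorPred k
      R : MorPred k
      L-prop : ∀ {a b} (f : Hom a b) → isProp (L f)
      R-prop : ∀ {a b} (f : Hom a b) → isProp (R f)
      L-id   : ∀ {a} → L (idₕ {a})
      R-id   : ∀ {a} → R (idₕ {a})
      L-comp : ∀ {a b c} {g : Hom b c} {f : Hom a b} → L f → L g → L (g ∘ f)
      R-comp : ∀ {a b c} {g : Hom b c} {f : Hom a b} → R f → R g → R (g ∘ f)
      fact   : ∀ {a b} (h : Hom a b) →
               isContr (Σ[ D ∈ Ob ] Σ[ f ∈ Hom a D ] Σ[ g ∈ Hom D b ]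
                          ((g ∘ f ≡ h) × L f × R g))

-- For l ∈ 𝓛 and r ∈ ℛ, the fillers of a square S are the fibre over S of the map
-- d ↦ (d ∘ l , r ∘ d , assoc r d l) into the type of commuting squares, so orthogonality
-- says that this map is an equivalence. Since composition is an equivalence from
-- (𝓛,ℛ)-factorizations to morphisms, a commuting square is the same as a factorization
-- of each of its sides such that the two induced factorizations of the diagonal agree,
-- i.e. the same as one factorization of a morphism B → C; the pentagon identifies the
-- composite equivalence with the map above.
-- Conversely, if l lifts against ℛ, factor l = r ∘ l′. Lifting against r with bottom idₕ
-- gives a section d of r, and both d ∘ r and idₕ fill the trivial square of l′ and r, so
-- d ∘ r ≡ idₕ by l′ ⊥ r. Hence r is bi-invertible and univalence carries 𝓛(l′) to 𝓛(l).
-- The characterization of ℛ is dual.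

module Submission where

open import Defs
open import Level using (Level; _⊔_)
open import Function.Bundles using (_⇔_; mk⇔; _↔_; Inverse; mk↔ₛ′)
open import Data.Product.Function.Dependent.Propositional using (Σ-↔)
open import Function.Properties.Inverse using (↔-trans)
open import Function.Properties.Inverse.HalfAdjointEquivalence using (_≃_; ↔⇒≃)
open import Data.Product using (Σ; Σ-syntax; _×_; _,_; proj₁; proj₂)
open import Relation.Binary.PropositionalEquality
  using (_≡_; refl; sym; trans; cong; cong₂; subst; module ≡-Reasoning)
open import Relation.Binary.PropositionalEquality.Properties
  using (trans-reflʳ; trans-assoc; trans-symˡ; trans-symʳ; sym-cong; trans-injectiveˡ; trans-injectiveʳ)

private variable
  a b c : Level
  A : Set a
  B : Set b
  C : Set c

open Inverse using (to; from; strictlyInverseˡ; strictlyInverseʳ)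

retract-isContr : (s : A → B) (r : B → A) → (∀ x → r (s x) ≡ x) → isContr B → isContr A
retract-isContr s r rs (centre , contraction) =
  r centre , λ x → trans (cong r (contraction (s x))) (rs x)

isContr⇒≡ : isContr A → (x y : A) → x ≡ y
isContr⇒≡ (centre , contraction) x y = trans (sym (contraction x)) (contraction y)

isEquiv⇒↔ : {f : A → B} → isEquiv f → A ↔ B
isEquiv⇒↔ {f = f} e = mk↔ₛ′ f
  (λ y → proj₁ (proj₁ (e y)))
  (λ y → proj₂ (proj₁ (e y)))
  (λ x → cong proj₁ (proj₂ (e (f x)) (x , refl)))

fiber-≡ : {f : A → B} {y : B} {x₁ x₂ : A} {p₁ : f x₁ ≡ y} {p₂ : f x₂ ≡ y}
  (q : x₁ ≡ x₂) → p₁ ≡ trans (cong f q) p₂ → _≡_ {A = fiber f y} (x₁ , p₁) (x₂ , p₂)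
fiber-≡ refl refl = refl

↔⇒isEquiv : (e : A ↔ B) → isEquiv (to e)
↔⇒isEquiv e y = (from e y , right-inverse-of y) , λ { (x , refl) → contraction x }
  where
  open _≃_ (↔⇒≃ e) using (left-inverse-of; right-inverse-of; left-right)
  contraction : ∀ x → _≡_ {A = fiber (to e) (to e x)} (from e (to e x) , right-inverse-of (to e x)) (x , refl)
  contraction x = fiber-≡ (left-inverse-of x)
    (trans (sym (left-right x)) (sym (trans-reflʳ _)))

cong-retraction : (h : A → B) (k : B → A) (kh : ∀ x → k (h x) ≡ x) {x y : A} (p : x ≡ y)
  → trans (sym (kh x)) (trans (cong k (cong h p)) (kh y)) ≡ p
cong-retraction h k kh {x} refl = trans-symˡ (kh x)

cong-↔ : (e : A ↔ B) {x y : A} → (x ≡ y) ↔ (to e x ≡ to e y)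
cong-↔ e {x} {y} = mk↔ₛ′ (cong (to e)) cong⁻¹ to-cong⁻¹ (cong-retraction (to e) (from e) η)
  where
  η = strictlyInverseʳ e
  ε = strictlyInverseˡ e
  cong⁻¹ : to e x ≡ to e y → x ≡ y
  cong⁻¹ q = trans (sym (η x)) (trans (cong (from e) q) (η y))
  from-cong-cong⁻¹ : ∀ q → cong (from e) (cong (to e) (cong⁻¹ q)) ≡ cong (from e) q
  from-cong-cong⁻¹ q = trans-injectiveˡ (η y) (trans-injectiveʳ (sym (η x))
    (cong-retraction (to e) (from e) η (cong⁻¹ q)))
  to-cong⁻¹ : ∀ q → cong (to e) (cong⁻¹ q) ≡ q
  to-cong⁻¹ q = begin
    cong (to e) (cong⁻¹ q)
      ≡⟨ sym (cong-retraction (from e) (to e) ε (cong (to e) (cong⁻¹ q))) ⟩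
    trans (sym (ε (to e x))) (trans (cong (to e) (cong (from e) (cong (to e) (cong⁻¹ q)))) (ε (to e y)))
      ≡⟨ cong (λ p → trans (sym (ε (to e x))) (trans (cong (to e) p) (ε (to e y)))) (from-cong-cong⁻¹ q) ⟩
    trans (sym (ε (to e x))) (trans (cong (to e) (cong (from e) q)) (ε (to e y)))
      ≡⟨ cong-retraction (from e) (to e) ε q ⟩
    q ∎
    where open ≡-Reasoning

whisker : {x x′ y y′ : A} → x′ ≡ x → y ≡ y′ → x ≡ y → x′ ≡ y′
whisker α β p = trans α (trans p β)

module _ {x x′ y y′ : A} where

  whisker-sym-whisker : (α : x′ ≡ x) (β : y ≡ y′) (q : x′ ≡ y′) → whisker α β (whisker (sym α) (sym β) q) ≡ q
  whisker-sym-whisker refl refl q = trans (trans-reflʳ _) (trans-reflʳ q)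

  whisker-whisker-sym : (α : x′ ≡ x) (β : y ≡ y′) (p : x ≡ y) → whisker (sym α) (sym β) (whisker α β p) ≡ p
  whisker-whisker-sym refl refl p = trans (trans-reflʳ _) (trans-reflʳ p)

  whisker-↔ : (α : x′ ≡ x) (β : y ≡ y′) → (x ≡ y) ↔ (x′ ≡ y′)
  whisker-↔ α β = mk↔ₛ′ (whisker α β) (whisker (sym α) (sym β)) (whisker-sym-whisker α β) (whisker-whisker-sym α β)

isEquiv-2-out-of-3 : (e : A ↔ B) (t : A ↔ C) (φ : B → C)
  → (∀ x → φ (to e x) ≡ to t x) → isEquiv φ
isEquiv-2-out-of-3 e t φ φe≗t = ↔⇒isEquiv (mk↔ₛ′ φ ψ φψ ψφ)
  where
  open ≡-Reasoning
  ψ = λ z → to e (from t z)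
  φψ : ∀ z → φ (ψ z) ≡ z
  φψ z = trans (φe≗t (from t z)) (strictlyInverseˡ t z)
  ψφ : ∀ y → ψ (φ y) ≡ y
  ψφ y = begin
    ψ (φ y)                 ≡⟨ cong (λ u → ψ (φ u)) (sym (strictlyInverseˡ e y)) ⟩
    ψ (φ (to e (from e y))) ≡⟨ cong ψ (φe≗t (from e y)) ⟩
    ψ (to t (from e y))     ≡⟨ cong (to e) (strictlyInverseʳ t (from e y)) ⟩
    to e (from e y)         ≡⟨ strictlyInverseˡ e y ⟩
    y ∎

trans-transposeˡ : {x y z : A} (p : x ≡ y) {q : y ≡ z} {s : x ≡ z} → trans p q ≡ s → q ≡ trans (sym p) s
trans-transposeˡ refl q≡s = q≡s

module WildCatProperties {i j : Level} (𝒞 : WildCat i j) where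
  open WildCat 𝒞

  private variable
    W X Y Z : Ob

  Square : Hom W X → Hom Y Z → Set j
  Square {W} {X} {Y} {Z} l r = Σ[ f ∈ Hom W Y ] Σ[ g ∈ Hom X Z ] (g ∘ l ≡ r ∘ f)

  IsFiller : {l : Hom W X} {r : Hom Y Z} {f : Hom W Y} {g : Hom X Z} → g ∘ l ≡ r ∘ f → Hom X Y → Set j
  IsFiller {l = l} {r} {f} {g} S d =
    Σ[ Hf ∈ d ∘ l ≡ f ] Σ[ Hg ∈ r ∘ d ≡ g ] (assoc r d l · ap (r ∘_) Hf ≡ ap (_∘ l) Hg · S)

  diagonalSquare : (l : Hom W X) (r : Hom Y Z) → Hom X Y → Square l r
  diagonalSquare l r d = d ∘ l , r ∘ d , assoc r d l

  module _ {l : Hom W X} {r : Hom Y Z} {f f′ : Hom W Y} {g g′ : Hom X Z}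
           {α : g′ ∘ l ≡ r ∘ f′} {S : g ∘ l ≡ r ∘ f} where

    Square-≡ : (Hf : f′ ≡ f) (Hg : g′ ≡ g) → α · ap (r ∘_) Hf ≡ ap (_∘ l) Hg · S
             → _≡_ {A = Square l r} (f′ , g′ , α) (f , g , S)
    Square-≡ refl refl refl = cong (λ s → f′ , g′ , s) (sym (trans-reflʳ α))

    Square-≡⁻¹ : _≡_ {A = Square l r} (f′ , g′ , α) (f , g , S)
               → Σ[ Hf ∈ f′ ≡ f ] Σ[ Hg ∈ g′ ≡ g ] (α · ap (r ∘_) Hf ≡ ap (_∘ l) Hg · S)
    Square-≡⁻¹ refl = refl , refl , trans-reflʳ α

  Square-≡⁻¹-Square-≡ : {l : Hom W X} {r : Hom Y Z} {f f′ : Hom W Y} {g g′ : Hom X Z}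
    {α : g′ ∘ l ≡ r ∘ f′} {S : g ∘ l ≡ r ∘ f} (Hf : f′ ≡ f) (Hg : g′ ≡ g) (c : α · ap (r ∘_) Hf ≡ ap (_∘ l) Hg · S)
    → Square-≡⁻¹ (Square-≡ Hf Hg c) ≡ (Hf , Hg , c)
  Square-≡⁻¹-Square-≡ {l = l} {r} {f′ = f′} {g′ = g′} {α} refl refl refl =
    trans (Square-≡⁻¹-cong (sym (trans-reflʳ α)))
          (cong (λ c → refl , refl , c) (trans-symʳ (trans-reflʳ α)))
    where
    Square-≡⁻¹-cong : {β : g′ ∘ l ≡ r ∘ f′} (q : α ≡ β)
      → Square-≡⁻¹ {S = β} (cong (λ s → f′ , g′ , s) q) ≡ (refl , refl , trans (trans-reflʳ α) q)
    Square-≡⁻¹-cong refl = cong (λ c → refl , refl , c) (sym (trans-reflʳ (trans-reflʳ α)))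

  isEquiv-diagonalSquare⇒isContr-fill : {l : Hom W X} {r : Hom Y Z} → isEquiv (diagonalSquare l r)
    → {f : Hom W Y} {g : Hom X Z} (S : g ∘ l ≡ r ∘ f) → isContr (fill 𝒞 S)
  isEquiv-diagonalSquare⇒isContr-fill diagonalSquare-isEquiv {f} {g} S = retract-isContr
    (λ { (d , Hf , Hg , c) → d , Square-≡ Hf Hg c })
    (λ { (d , q) → d , Square-≡⁻¹ q })
    (λ { (d , Hf , Hg , c) → cong (d ,_) (Square-≡⁻¹-Square-≡ Hf Hg c) })
    (diagonalSquare-isEquiv (f , g , S))

  module _ (univalent : isUnivalent 𝒞) {k : Level} (P : MorPred 𝒞 k) where

    private
      idtoBiInv-∘ˡ : (p : X ≡ Y) {f : Hom W X} → P f → P (proj₁ (idtoBiInv 𝒞 p) ∘ f)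
      idtoBiInv-∘ˡ refl {f} = subst P (sym (Lid f))

      idtoBiInv-∘ʳ : (p : X ≡ Y) {f : Hom Y Z} → P f → P (f ∘ proj₁ (idtoBiInv 𝒞 p))
      idtoBiInv-∘ʳ refl {f} = subst P (sym (Rid f))

    biInv-∘ˡ-preserves : {e : Hom X Y} → isBiInv 𝒞 e → {f : Hom W X} → P f → P (e ∘ f)
    biInv-∘ˡ-preserves {X = X} {Y = Y} {e = e} e-biInv Pf with proj₁ (univalent X Y (e , e-biInv))
    ... | p , refl = idtoBiInv-∘ˡ p Pf

    biInv-∘ʳ-preserves : {e : Hom X Y} → isBiInv 𝒞 e → {f : Hom Y Z} → P f → P (f ∘ e)
    biInv-∘ʳ-preserves {X = X} {Y = Y} {e = e} e-biInv Pf with proj₁ (univalent X Y (e , e-biInv))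
    ... | p , refl = idtoBiInv-∘ʳ p Pf

module WildBicatProperties {i j : Level} (𝒞 : WildBicat i j) where
  open WildBicat 𝒞
  open WildCatProperties cat

  private variable
    V W X Y Z : Ob

  pentagon′ : (k : Hom Y Z) (h : Hom X Y) (g : Hom W X) (f : Hom V W)
    → assoc k (h ∘ g) f · ap (k ∘_) (assoc h g f)
      ≡ ap (_∘ f) (sym (assoc k h g)) · assoc (k ∘ h) g f · assoc k h (g ∘ f)
  pentagon′ k h g f = trans (trans-transposeˡ (ap (_∘ f) (assoc k h g)) (pentagon k h g f))
    (cong (_· assoc (k ∘ h) g f · assoc k h (g ∘ f)) (sym-cong (assoc k h g)))

  idₕ-isFiller : (l : Hom X Y) (r : Hom Y Z) → IsFiller {l = l} {r} {f = l} {g = r} refl idₕ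
  idₕ-isFiller l r = Lid l , Rid r , trans (triangle r l) (sym (trans-reflʳ _))

  unique-filler≡idₕ : {l : Hom X Y} {r : Hom Y Z} {S : r ∘ l ≡ r ∘ l} → S ≡ refl
    → isContr (fill cat S) → {d : Hom Y Y} → IsFiller S d → d ≡ idₕ
  unique-filler≡idₕ {l = l} {r} refl fill-isContr d-isFiller =
    cong proj₁ (isContr⇒≡ fill-isContr (_ , d-isFiller) (idₕ , idₕ-isFiller l r))

  isFiller-precompose : {l : Hom V W} {k : Hom W X} {f : Hom V Y} {r : Hom Y Z} {g : Hom X Z} {g′ : Hom W Z}
    {S : g ∘ (k ∘ l) ≡ r ∘ f} (p : g ∘ k ≡ g′)
    → {d : Hom X Y} → IsFiller S d → IsFiller (ap (_∘ l) (sym p) · assoc g k l · S) (d ∘ k)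
  isFiller-precompose {l = l} {k} {r = r} refl {d} (refl , refl , refl) =
    assoc d k l , sym (assoc r d k) ,
    trans (pentagon′ r d k l)
      (cong (λ q → ap (_∘ l) (sym (assoc r d k)) · assoc (r ∘ d) k l · q) (sym (trans-reflʳ _)))

  isFiller-postcompose : {l : Hom V W} {f : Hom V X} {r : Hom X Y} {k : Hom Y Z} {g : Hom W Z} {f′ : Hom V Y}
    {S : g ∘ l ≡ (k ∘ r) ∘ f} (p : r ∘ f ≡ f′)
    → {d : Hom W X} → IsFiller S d → IsFiller (S · assoc k r f · ap (k ∘_) p) (r ∘ d)
  isFiller-postcompose {l = l} {r = r} {k} refl {d} (refl , refl , refl) =
    assoc r d l , sym (assoc k r d) ,
    trans (pentagon′ k r d l)
      (cong (ap (_∘ l) (sym (assoc k r d)) ·_)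
        (cong₂ _·_ (sym (trans-reflʳ (assoc (k ∘ r) d l))) (sym (trans-reflʳ (assoc k r (d ∘ l))))))

module OFSProperties {i j k : Level} (𝒞 : WildBicat i j) (O : OFS (WildBicat.cat 𝒞) k) where
  open WildBicat 𝒞
  open OFS O
  open WildCatProperties cat
  open WildBicatProperties 𝒞

  private variable
    W X Y Z : Ob

  Factorization : Ob → Ob → Set (i ⊔ j ⊔ k)
  Factorization X Y = Σ[ M ∈ Ob ] Σ[ u ∈ Hom X M ] Σ[ v ∈ Hom M Y ] (L u × R v)

  composite : Factorization X Y → Hom X Y
  composite (_ , u , v , _) = v ∘ u

  Factorization↔Hom : Factorization X Y ↔ Hom X Y
  Factorization↔Hom = isEquiv⇒↔ {f = composite} λ h → retract-isContr
    (λ { ((M , u , v , Lu , Rv) , vu≡h) → M , u , v , vu≡h , Lu , Rv })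
    (λ { (M , u , v , vu≡h , Lu , Rv) → (M , u , v , Lu , Rv) , vu≡h })
    (λ _ → refl)
    (fact h)

  module _ {l : Hom W X} {r : Hom Y Z} (Ll : L l) (Rr : R r) where

    precompose : Factorization X Z → Factorization W Z
    precompose (M , u , v , Lu , Rv) = M , u ∘ l , v , L-comp Ll Lu , Rv

    postcompose : Factorization W Y → Factorization W Z
    postcompose (M , u , v , Lu , Rv) = M , u , r ∘ v , Lu , R-comp Rv Rr

    composite-precompose : (K : Factorization X Z) → composite K ∘ l ≡ composite (precompose K)
    composite-precompose (_ , u , v , _) = assoc v u l

    composite-postcompose : (K : Factorization W Y) → composite (postcompose K) ≡ r ∘ composite K
    composite-postcompose (_ , u , v , _) = assoc r v u

    FactorizationSquare : Set (i ⊔ j ⊔ k)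
    FactorizationSquare = Σ[ K ∈ Factorization W Y ] Σ[ K′ ∈ Factorization X Z ] (precompose K′ ≡ postcompose K)

    Factorization↔FactorizationSquare : Factorization X Y ↔ FactorizationSquare
    Factorization↔FactorizationSquare = mk↔ₛ′ square diagonal square-diagonal (λ _ → refl)
      where
      square : Factorization X Y → FactorizationSquare
      square (M , u , v , Lu , Rv) = (M , u ∘ l , v , L-comp Ll Lu , Rv) , (M , u , r ∘ v , Lu , R-comp Rv Rr) , refl
      diagonal : FactorizationSquare → Factorization X Y
      diagonal ((M , _ , v , _ , Rv) , (_ , u , _ , Lu , _) , refl) = M , u , v , Lu , Rv
      square-diagonal : ∀ Q → square (diagonal Q) ≡ Q
      square-diagonal ((M , _ , v , _ , Rv) , (_ , u , _ , Lu , _) , refl) = refl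

    FactorizationSquare↔Square : FactorizationSquare ↔ Square l r
    FactorizationSquare↔Square =
      Σ-↔ Factorization↔Hom λ {K} → Σ-↔ Factorization↔Hom λ {K′} →
        ↔-trans (cong-↔ Factorization↔Hom) (whisker-↔ (composite-precompose K′) (composite-postcompose K))

    Factorization↔Square : Factorization X Y ↔ Square l r
    Factorization↔Square = ↔-trans Factorization↔FactorizationSquare FactorizationSquare↔Square

    diagonalSquare-composite : (G : Factorization X Y) → diagonalSquare l r (composite G) ≡ to Factorization↔Square G
    diagonalSquare-composite (_ , u , v , _ , _) = Square-≡ (assoc v u l) (sym (assoc r v u)) (pentagon′ r v u l)

  L⊥R : {l : Hom W X} {r : Hom Y Z} → L l → R r
    → {f : Hom W Y} {g : Hom X Z} (S : g ∘ l ≡ r ∘ f) → isContr (fill cat S)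
  L⊥R {l = l} {r} Ll Rr = isEquiv-diagonalSquare⇒isContr-fill
    (isEquiv-2-out-of-3 Factorization↔Hom (Factorization↔Square Ll Rr) (diagonalSquare l r)
      (diagonalSquare-composite Ll Rr))

  L⇒LLP-R : {l : Hom W X} → L l → LLP cat R l
  L⇒LLP-R Ll _ _ _ Rr = L⊥R Ll Rr

  R⇒RLP-L : {r : Hom Y Z} → R r → RLP cat L r
  R⇒RLP-L Rr _ _ _ Ll = L⊥R Ll Rr

  LLP-R⇒biInv : {l : Hom W X} {r : Hom X Y} → L l → R r → LLP cat R (r ∘ l) → isBiInv cat r
  LLP-R⇒biInv {l = l} {r} Ll Rr r∘l-LLP = (d , d∘r≡idₕ) , (d , r∘d≡idₕ)
    where
    -- The lifting problem is posed with its bottom-left corner rebracketed so that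
    -- precomposing its filler with r fills the trivial square r ∘ l ≡ r ∘ l.
    rebracket : r ∘ l ≡ idₕ ∘ (r ∘ l)
    rebracket = ap (_∘ l) (sym (Lid r)) · assoc idₕ r l
    F = proj₁ (r∘l-LLP l r idₕ Rr (sym rebracket))
    d = proj₁ F
    r∘d≡idₕ = proj₁ (proj₂ (proj₂ F))
    d∘r≡idₕ : d ∘ r ≡ idₕ
    d∘r≡idₕ = unique-filler≡idₕ (trans (sym (trans-assoc (ap (_∘ l) (sym (Lid r))))) (trans-symʳ rebracket))
      (L⊥R Ll Rr _) (isFiller-precompose (Lid r) (proj₂ F))

  RLP-L⇒biInv : {l : Hom W X} {r : Hom X Y} → L l → R r → RLP cat L (r ∘ l) → isBiInv cat l
  RLP-L⇒biInv {l = l} {r} Ll Rr r∘l-RLP = (d , d∘l≡idₕ) , (d , l∘d≡idₕ)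
    where
    rebracket : (r ∘ l) ∘ idₕ ≡ r ∘ l
    rebracket = assoc r l idₕ · ap (r ∘_) (Rid l)
    F = proj₁ (r∘l-RLP idₕ l r Ll (sym rebracket))
    d = proj₁ F
    d∘l≡idₕ = proj₁ (proj₂ F)
    l∘d≡idₕ : l ∘ d ≡ idₕ
    l∘d≡idₕ = unique-filler≡idₕ (trans-symˡ rebracket) (L⊥R Ll Rr _) (isFiller-postcompose (Rid l) (proj₂ F))

  module _ (univalent : isUnivalent cat) where

    LLP-R⇒L : {l : Hom W X} → LLP cat R l → L l
    LLP-R⇒L {l = l} l-LLP with proj₁ (fact l)
    ... | (_ , l′ , r , refl , Ll′ , Rr) = biInv-∘ˡ-preserves univalent L (LLP-R⇒biInv Ll′ Rr l-LLP) Ll′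

    RLP-L⇒R : {r : Hom Y Z} → RLP cat L r → R r
    RLP-L⇒R {r = r} r-RLP with proj₁ (fact r)
    ... | (_ , l , r′ , refl , Ll , Rr′) = biInv-∘ʳ-preserves univalent R (RLP-L⇒biInv Ll Rr′ r-RLP) Rr′

mainTheorem8 : ∀ {i j k : Level} (𝒞 : WildBicat i j)
    → isUnivalent (WildBicat.cat 𝒞)
    → (O : OFS (WildBicat.cat 𝒞) k)
    → (∀ {a b} (l : WildBicat.Hom 𝒞 a b)
         → OFS.L O l ⇔ LLP (WildBicat.cat 𝒞) (OFS.R O) l)
    × (∀ {a b} (r : WildBicat.Hom 𝒞 a b)
         → OFS.R O r ⇔ RLP (WildBicat.cat 𝒞) (OFS.L O) r)
mainTheorem8 𝒞 univalent O =
  (λ l → mk⇔ L⇒LLP-R (LLP-R⇒L univalent)) , (λ r → mk⇔ R⇒RLP-L (RLP-L⇒R univalent))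
  where open OFSProperties 𝒞 O
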